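{- Let $g(t)=\sum_k a_kt^k\in\mathbb{C}[t]$, let $n$ be a positive integer and $\ell\ge0$ an integer. Then $[n]_t^{\ell+1}$ divides $g(t)$ if and only if \[ \frac1n g(t)\equiv\sum_{k\equiv0\bmod n}a_kt^k\equiv\sum_{k\equiv1\bmod n}a_kt^k\equiv\cdots\equiv\sum_{k\equiv n-1\bmod n}a_kt^k \pmod{(1-t)^{\ell+1}}. \]
   Context: $[n]_t:=\frac{1-t^n}{1-t}=1+t+\dots+t^{n-1}$. -}

module Defs where

open import Level using (Level; _⊔_)
open import Algebra.Bundles using (CommutativeRing)
open import Data.Nat as ℕ using (ℕ; zero; suc; NonZero; _%_)
open import Data.Fin using (Fin; toℕ)
open import Data.List using (List; []; _∷_; map; replicate)
open import Data.Product using (∃)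
open import Relation.Nullary using (¬_)
open import Relation.Binary.PropositionalEquality using (_≡_)

natToR : ∀ {c ℓ} (R : CommutativeRing c ℓ) → ℕ → CommutativeRing.Carrier R
natToR R zero    = CommutativeRing.0# R
natToR R (suc m) = CommutativeRing._+_ R (CommutativeRing.1# R) (natToR R m)

-- A field of characteristic zero (ℂ is the instance relevant to the paper).
record CharZeroField (c ℓ : Level) : Set (Level.suc (c ⊔ ℓ)) where
  field
    commutativeRing : CommutativeRing c ℓ
  open CommutativeRing commutativeRing public
  field
    0≉1      : ¬ (0# ≈ 1#)
    _⁻¹      : (x : Carrier) → ¬ (x ≈ 0#) → Carrier
    inverseˡ : (x : Carrier) (p : ¬ (x ≈ 0#)) → (x ⁻¹) p * x ≈ 1#
    charZero : (m : ℕ) → ¬ (natToR commutativeRing (suc m) ≈ 0#)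

-- Polynomials over a commutative ring, as coefficient lists
-- (a₀ ∷ a₁ ∷ … ∷ aₘ ∷ [] represents a₀ + a₁ t + … + aₘ tᵐ).
module Poly {c ℓ : Level} (R : CommutativeRing c ℓ) where
  open CommutativeRing R

  Pol : Set c
  Pol = List Carrier

  coeff : Pol → ℕ → Carrier
  coeff []       _       = 0#
  coeff (a ∷ p)  zero    = a
  coeff (a ∷ p)  (suc k) = coeff p k

  -- equality of polynomials: all coefficients equal (trailing zeros irrelevant)
  _≈ₚ_ : Pol → Pol → Set ℓ
  p ≈ₚ q = ∀ k → coeff p k ≈ coeff q k

  _+ₚ_ : Pol → Pol → Pol
  []      +ₚ q       = q
  (a ∷ p) +ₚ []      = a ∷ p
  (a ∷ p) +ₚ (b ∷ q) = (a + b) ∷ (p +ₚ q)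

  -ₚ_ : Pol → Pol
  -ₚ p = map -_ p

  _-ₚ_ : Pol → Pol → Pol
  p -ₚ q = p +ₚ (-ₚ q)

  _·ₚ_ : Carrier → Pol → Pol
  a ·ₚ p = map (a *_) p

  _*ₚ_ : Pol → Pol → Pol
  []      *ₚ q = []
  (a ∷ p) *ₚ q = (a ·ₚ q) +ₚ (0# ∷ (p *ₚ q))

  1ₚ : Pol
  1ₚ = 1# ∷ []

  _^ₚ_ : Pol → ℕ → Pol
  p ^ₚ zero  = 1ₚ
  p ^ₚ suc k = p *ₚ (p ^ₚ k)

  _∣ₚ_ : Pol → Pol → Set (c ⊔ ℓ)
  d ∣ₚ p = ∃ λ q → p ≈ₚ (q *ₚ d)

  _≡_[modₚ_] : Pol → Pol → Pol → Set (c ⊔ ℓ)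
  p ≡ q [modₚ m ] = m ∣ₚ (p -ₚ q)

  qInt : ℕ → Pol
  qInt n = replicate n 1#

  oneMinusT : Pol
  oneMinusT = 1# ∷ (- 1#) ∷ []

  -- keep the coefficients a_k with k ≡ r (mod n), zero the others;
  -- the list index starts at position k
  residuePartFrom : (n : ℕ) .{{_ : NonZero n}} → ℕ → ℕ → Pol → Pol
  residuePartFrom n r k []      = []
  residuePartFrom n r k (a ∷ p) with k % n ℕ.≟ r
  ... | Relation.Nullary.yes _ = a  ∷ residuePartFrom n r (suc k) p
  ... | Relation.Nullary.no  _ = 0# ∷ residuePartFrom n r (suc k) p

  residuePart : (n : ℕ) .{{_ : NonZero n}} → ℕ → Pol → Pol
  residuePart n r g = residuePartFrom n r 0 g

invNat : ∀ {c ℓ} (F : CharZeroField c ℓ) (n : ℕ) → .{{_ : NonZero n}} →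
         CharZeroField.Carrier F
invNat F (suc m) = CharZeroField._⁻¹ F (natToR (CharZeroField.commutativeRing F) (suc m)) (CharZeroField.charZero F m)

{-# OPTIONS --safe #-}
-- Write Φ = [n]_t, u = 1 - t, and g_r for the part of g on the exponents ≡ r (mod n).
-- Multiplication by 1 - tⁿ = uΦ commutes with g ↦ g_r, while t shifts the classes, so
-- (uh)_{r+1} = h_{r+1} - t h_r. For h = Φf and Δ_r = h_{r+1} - h_r this gives
-- Δ_{r+1} - t Δ_r = uΦ (f_{r+2} - f_{r+1}); summing over one period, Φ Δ_r ≡ 0 modulo u^{m+1}
-- as soon as the f_r are congruent modulo u^m. Since Φ ≡ n is a unit modulo every power of u,
-- the residue parts of f are congruent modulo u^m iff those of Φf are congruent modulo u^{m+1}.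
-- If the residue parts of g are congruent modulo u, every residue part of ug vanishes at t = 1,
-- hence is divisible by 1 - tⁿ; so uΦ ∣ ug and Φ ∣ g. By induction Φ^m ∣ g iff the residue
-- parts of g are congruent modulo u^m, and as they sum to g, iff each of them is ≡ g/n.
module Submission where

open import Defs
open import Level using (_⊔_)
open import Algebra.Bundles using (CommutativeRing)
open import Data.Nat as ℕ using (ℕ; zero; suc; NonZero; _%_)
open import Data.Fin using (Fin; toℕ)
open import Function.Bundles using (_⇔_)
open import Function.Construct.Composition using (_⇔-∘_)
import Data.Nat.Properties as ℕ
open import Data.Integer as ℤ using (ℤ; +_; -[1+_]; _◃_; sign; ∣_∣; _⊖_)
import Data.Integer.Properties as ℤ
open import Data.Sign as Sign using (Sign)
open import Data.Maybe using (Maybe; just; nothing)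
open import Relation.Nullary using (yes; no)
open import Relation.Binary.PropositionalEquality as ≡ using (_≡_)

module IntegerCoefficientSolver {c ℓ} (R : CommutativeRing c ℓ) where

  open CommutativeRing R
  open import Algebra.Properties.Ring ring using (-1*x≈-x)
  open import Algebra.Properties.AbelianGroup +-abelianGroup using (⁻¹-∙-comm)
  open import Algebra.Properties.Group +-group using (ε⁻¹≈ε; ⁻¹-involutive)
  open import Algebra.Properties.CommutativeSemigroup *-commutativeSemigroup using (interchange)
  open import Algebra.Properties.CommutativeSemigroup +-commutativeSemigroup using ()
    renaming (interchange to +-interchange)
  open import Algebra.Properties.Semiring.Mult.TCOptimised semiring using (_×_; 1+×; ×-homo-+; ×1-homo-*)
  open import Algebra.Solver.Ring.AlmostCommutativeRing using (fromCommutativeRing; _-Raw-AlmostCommutative⟶_)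
  open import Relation.Binary.Reasoning.Setoid setoid

  -- The optimised _×_ has 1 × x = x, so that the constant con (+ 1) denotes 1# definitionally.
  ⟦_⟧ : ℤ → Carrier
  ⟦ + n ⟧      = n × 1#
  ⟦ -[1+ n ] ⟧ = - (suc n × 1#)

  1+x-[1+y]≈x-y : ∀ x y → (1# + x) - (1# + y) ≈ x - y
  1+x-[1+y]≈x-y x y = begin
    (1# + x) - (1# + y)      ≈⟨ +-congˡ (sym (⁻¹-∙-comm 1# y)) ⟩
    (1# + x) + (- 1# + - y)  ≈⟨ +-interchange 1# x (- 1#) (- y) ⟩
    (1# - 1#) + (x - y)      ≈⟨ +-congʳ (-‿inverseʳ 1#) ⟩
    0# + (x - y)             ≈⟨ +-identityˡ _ ⟩
    x - y                    ∎

  ⊖-homo : ∀ m n → ⟦ m ⊖ n ⟧ ≈ ⟦ + m ⟧ - ⟦ + n ⟧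
  ⊖-homo m zero rewrite ℤ.⊖-≥ {m} {0} ℕ.z≤n = sym (trans (+-congˡ ε⁻¹≈ε) (+-identityʳ _))
  ⊖-homo zero (suc n) rewrite ℤ.⊖-≤ {0} {suc n} ℕ.z≤n = sym (+-identityˡ _)
  ⊖-homo (suc m) (suc n) rewrite ℤ.[1+m]⊖[1+n]≡m⊖n m n =
    trans (⊖-homo m n) (sym (trans (+-cong (1+× m 1#) (-‿cong (1+× n 1#))) (1+x-[1+y]≈x-y (m × 1#) (n × 1#))))

  +-homo : ∀ i j → ⟦ i ℤ.+ j ⟧ ≈ ⟦ i ⟧ + ⟦ j ⟧
  +-homo (+ m)    (+ n)    = ×-homo-+ 1# m n
  +-homo (+ m)    -[1+ n ] = ⊖-homo m (suc n)
  +-homo -[1+ m ] (+ n)    = trans (⊖-homo n (suc m)) (+-comm _ _)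
  +-homo -[1+ m ] -[1+ n ] = begin
    - (suc (suc (m ℕ.+ n)) × 1#) ≡⟨ ≡.cong (λ k → - (suc k × 1#)) (ℕ.+-suc m n) ⟨
    - ((suc m ℕ.+ suc n) × 1#)   ≈⟨ -‿cong (×-homo-+ 1# (suc m) (suc n)) ⟩
    - (suc m × 1# + suc n × 1#)  ≈⟨ ⁻¹-∙-comm _ _ ⟨
    ⟦ -[1+ m ] ⟧ + ⟦ -[1+ n ] ⟧  ∎

  -‿homo : ∀ i → ⟦ ℤ.- i ⟧ ≈ - ⟦ i ⟧
  -‿homo (+ zero)  = sym ε⁻¹≈ε
  -‿homo (+ suc n) = refl
  -‿homo -[1+ n ]  = sym (⁻¹-involutive _)

  ⟦sign⟧ : Sign → Carrier
  ⟦sign⟧ Sign.+ = 1#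
  ⟦sign⟧ Sign.- = - 1#

  ⟦sign⟧-homo : ∀ s t → ⟦sign⟧ (s Sign.* t) ≈ ⟦sign⟧ s * ⟦sign⟧ t
  ⟦sign⟧-homo Sign.+ _      = sym (*-identityˡ _)
  ⟦sign⟧-homo Sign.- Sign.+ = sym (*-identityʳ _)
  ⟦sign⟧-homo Sign.- Sign.- = sym (trans (-1*x≈-x (- 1#)) (⁻¹-involutive _))

  ⟦◃⟧ : ∀ s n → ⟦ s ◃ n ⟧ ≈ ⟦sign⟧ s * (n × 1#)
  ⟦◃⟧ s      zero    = sym (zeroʳ _)
  ⟦◃⟧ Sign.+ (suc n) = sym (*-identityˡ _)
  ⟦◃⟧ Sign.- (suc n) = sym (-1*x≈-x _)

  ⟦sign⟧*⟦abs⟧ : ∀ i → ⟦ i ⟧ ≈ ⟦sign⟧ (sign i) * (∣ i ∣ × 1#)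
  ⟦sign⟧*⟦abs⟧ (+ n)    = sym (*-identityˡ _)
  ⟦sign⟧*⟦abs⟧ -[1+ n ] = sym (-1*x≈-x _)

  *-homo : ∀ i j → ⟦ i ℤ.* j ⟧ ≈ ⟦ i ⟧ * ⟦ j ⟧
  *-homo i j = begin
    ⟦ (sign i Sign.* sign j) ◃ (∣ i ∣ ℕ.* ∣ j ∣) ⟧
      ≈⟨ ⟦◃⟧ (sign i Sign.* sign j) (∣ i ∣ ℕ.* ∣ j ∣) ⟩
    ⟦sign⟧ (sign i Sign.* sign j) * ((∣ i ∣ ℕ.* ∣ j ∣) × 1#)
      ≈⟨ *-cong (⟦sign⟧-homo (sign i) (sign j)) (×1-homo-* ∣ i ∣ ∣ j ∣) ⟩
    (⟦sign⟧ (sign i) * ⟦sign⟧ (sign j)) * ((∣ i ∣ × 1#) * (∣ j ∣ × 1#))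
      ≈⟨ interchange _ _ _ _ ⟩
    (⟦sign⟧ (sign i) * (∣ i ∣ × 1#)) * (⟦sign⟧ (sign j) * (∣ j ∣ × 1#))
      ≈⟨ *-cong (⟦sign⟧*⟦abs⟧ i) (⟦sign⟧*⟦abs⟧ j) ⟨
    ⟦ i ⟧ * ⟦ j ⟧ ∎

  homomorphism : ℤ.+-*-rawRing -Raw-AlmostCommutative⟶ fromCommutativeRing R
  homomorphism = record
    { ⟦_⟧ = ⟦_⟧ ; +-homo = +-homo ; *-homo = *-homo ; -‿homo = -‿homo
    ; 0-homo = refl ; 1-homo = refl }

  ⟦⟧-≟ : ∀ i j → Maybe (⟦ i ⟧ ≈ ⟦ j ⟧)
  ⟦⟧-≟ i j with i ℤ.≟ j
  ... | yes ≡.refl = just refl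
  ... | no _       = nothing

  open import Algebra.Solver.Ring ℤ.+-*-rawRing (fromCommutativeRing R) homomorphism ⟦⟧-≟ public
    using (solve; _:=_; _:+_; _:*_; _:-_; :-_; con)

module CommutativeRingDivisibility {c ℓ} (R : CommutativeRing c ℓ) where

  open CommutativeRing R
  open import Algebra.Properties.CommutativeSemigroup.Divisibility *-commutativeSemigroup public
  open import Algebra.Properties.Monoid.Divisibility *-monoid using (∣ʳ-refl)
  open import Algebra.Properties.Semiring.Exp semiring using (_^_)
  open import Data.Product using (∃; _,_)
  open IntegerCoefficientSolver R using (solve; _:=_; _:+_; _:*_; _:-_; con)

  ∣-+ : ∀ {d x y} → d ∣ x → d ∣ y → d ∣ x + y
  ∣-+ {d} (p , pd≈x) (q , qd≈y) = p + q , trans (distribʳ d p q) (+-cong pd≈x qd≈y)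

  ∣-‿ : ∀ {d x} → d ∣ x → d ∣ - x
  ∣-‿ {d} (p , pd≈x) = - p , trans (sym (-‿distribˡ-* p d)) (-‿cong pd≈x)
    where open import Algebra.Properties.Ring ring using (-‿distribˡ-*)

  ∣-- : ∀ {d x y} → d ∣ x → d ∣ y → d ∣ x - y
  ∣-- d∣x d∣y = ∣-+ d∣x (∣-‿ d∣y)

  ∣^ : ∀ {a e} k → a ∣ e → a ^ k ∣ e ^ k
  ∣^ zero    _   = ∣ʳ-refl
  ∣^ (suc k) a∣e = ∙-cong-∣ a∣e (∣^ k a∣e)

  x≈x[1-cb]^k+y*bx : ∀ b c x k → ∃ λ y → x ≈ x * (1# - c * b) ^ k + y * (b * x)
  x≈x[1-cb]^k+y*bx b c x zero    = 0# , solve 3 (λ b c x → x := x :* con (ℤ.+ 1) :+ con (ℤ.+ 0) :* (b :* x)) refl b c x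
  x≈x[1-cb]^k+y*bx b c x (suc k) with x≈x[1-cb]^k+y*bx b c x k
  ... | y , x≈xEᵏ+y*bx = y + (1# - c * b) ^ k * c , trans x≈xEᵏ+y*bx
    (solve 5 (λ b c x y E → x :* E :+ y :* (b :* x) := x :* ((con (ℤ.+ 1) :- c :* b) :* E) :+ (y :+ E :* c) :* (b :* x))
      refl b c x y ((1# - c * b) ^ k))

  ^∣*-invertible⇒^∣ : ∀ {a b} c k {x} → a ∣ 1# - c * b → a ^ k ∣ b * x → a ^ k ∣ x
  ^∣*-invertible⇒^∣ {a} {b} c k {x} a∣1-cb aᵏ∣bx with x≈x[1-cb]^k+y*bx b c x k
  ... | y , x≈xEᵏ+y*bx =
    ∣ʳ-respʳ-≈ (sym x≈xEᵏ+y*bx) (∣-+ (x∣ʳy⇒x∣ʳzy x (∣^ k a∣1-cb)) (x∣ʳy⇒x∣ʳzy y aᵏ∣bx))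

  Cancellable : Carrier → Set (c ⊔ ℓ)
  Cancellable a = ∀ {x y} → a * x ≈ a * y → x ≈ y

  *∣*⇒∣ : ∀ {a b x} → Cancellable a → a * b ∣ a * x → b ∣ x
  *∣*⇒∣ {a} {b} {x} cancel (q , q[ab]≈ax) = q , cancel (begin
    a * (q * b) ≈⟨ solve 3 (λ a b q → a :* (q :* b) := q :* (a :* b)) refl a b q ⟩
    q * (a * b) ≈⟨ q[ab]≈ax ⟩
    a * x       ∎)
    where open import Relation.Binary.Reasoning.Setoid setoid

module PolynomialRing {c ℓ} (R : CommutativeRing c ℓ) where

  open CommutativeRing R hiding (zero)
  open Poly R
  open import Data.List using ([]; _∷_)
  open import Data.Product using (_,_)
  open import Function using (_∘_)
  open import Algebra.Properties.Group +-group using (ε⁻¹≈ε)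
  open import Algebra.Properties.CommutativeSemigroup +-commutativeSemigroup using (interchange)

  -- Coefficientwise equality, wrapped in a record so that both polynomials
  -- can be inferred from a proof of it.
  infix 4 _≋_
  record _≋_ (p q : Pol) : Set ℓ where
    constructor mk≋
    field at : ∀ k → coeff p k ≈ coeff q k
  open _≋_ public

  ≋-refl : ∀ {p} → p ≋ p
  ≋-refl = mk≋ λ _ → refl

  ≋-sym : ∀ {p q} → p ≋ q → q ≋ p
  ≋-sym p≋q = mk≋ λ k → sym (at p≋q k)

  ≋-trans : ∀ {p q r} → p ≋ q → q ≋ r → p ≋ r
  ≋-trans p≋q q≋r = mk≋ λ k → trans (at p≋q k) (at q≋r k)

  ≋-tail : ∀ {a b p q} → (a ∷ p) ≋ (b ∷ q) → p ≋ q
  ≋-tail e = mk≋ (at e ∘ suc)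

  ≋-reflexive : ∀ {p q} → p ≡ q → p ≋ q
  ≋-reflexive ≡.refl = ≋-refl

  ∷-cong : ∀ {a b p q} → a ≈ b → p ≋ q → (a ∷ p) ≋ (b ∷ q)
  ∷-cong a≈b p≋q = mk≋ λ { zero → a≈b ; (suc k) → at p≋q k }

  0∷-zero : ∀ {p} → p ≋ [] → (0# ∷ p) ≋ []
  0∷-zero p≋[] = mk≋ λ { zero → refl ; (suc k) → at p≋[] k }

  coeff-+ₚ : ∀ p q k → coeff (p +ₚ q) k ≈ coeff p k + coeff q k
  coeff-+ₚ []      q       k       = sym (+-identityˡ _)
  coeff-+ₚ (a ∷ p) []      k       = sym (+-identityʳ _)
  coeff-+ₚ (a ∷ p) (b ∷ q) zero    = refl
  coeff-+ₚ (a ∷ p) (b ∷ q) (suc k) = coeff-+ₚ p q k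

  coeff-‿ₚ : ∀ p k → coeff (-ₚ p) k ≈ - coeff p k
  coeff-‿ₚ []      k       = sym ε⁻¹≈ε
  coeff-‿ₚ (a ∷ p) zero    = refl
  coeff-‿ₚ (a ∷ p) (suc k) = coeff-‿ₚ p k

  coeff-·ₚ : ∀ a p k → coeff (a ·ₚ p) k ≈ a * coeff p k
  coeff-·ₚ a []      k       = sym (zeroʳ a)
  coeff-·ₚ a (b ∷ p) zero    = refl
  coeff-·ₚ a (b ∷ p) (suc k) = coeff-·ₚ a p k

  +ₚ-cong : ∀ {p p' q q'} → p ≋ p' → q ≋ q' → p +ₚ q ≋ p' +ₚ q'
  +ₚ-cong {p} {p'} {q} {q'} p≋p' q≋q' = mk≋ λ k →
    trans (coeff-+ₚ p q k) (trans (+-cong (at p≋p' k) (at q≋q' k)) (sym (coeff-+ₚ p' q' k)))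

  +ₚ-congˡ : ∀ p {q q'} → q ≋ q' → p +ₚ q ≋ p +ₚ q'
  +ₚ-congˡ p = +ₚ-cong (≋-refl {p})

  +ₚ-congʳ : ∀ q {p p'} → p ≋ p' → p +ₚ q ≋ p' +ₚ q
  +ₚ-congʳ q p≋p' = +ₚ-cong p≋p' (≋-refl {q})

  -ₚ-cong : ∀ {p p'} → p ≋ p' → -ₚ p ≋ -ₚ p'
  -ₚ-cong {p} {p'} p≋p' = mk≋ λ k →
    trans (coeff-‿ₚ p k) (trans (-‿cong (at p≋p' k)) (sym (coeff-‿ₚ p' k)))

  ·ₚ-cong : ∀ {a b p q} → a ≈ b → p ≋ q → a ·ₚ p ≋ b ·ₚ q
  ·ₚ-cong {a} {b} {p} {q} a≈b p≋q = mk≋ λ k →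
    trans (coeff-·ₚ a p k) (trans (*-cong a≈b (at p≋q k)) (sym (coeff-·ₚ b q k)))

  ·ₚ-zeroˡ : ∀ {a} p → a ≈ 0# → a ·ₚ p ≋ []
  ·ₚ-zeroˡ {a} p a≈0 = mk≋ λ k → trans (coeff-·ₚ a p k) (trans (*-congʳ a≈0) (zeroˡ _))

  +ₚ-assoc : ∀ p q r → (p +ₚ q) +ₚ r ≋ p +ₚ (q +ₚ r)
  +ₚ-assoc p q r = mk≋ λ k → begin
    coeff ((p +ₚ q) +ₚ r) k               ≈⟨ trans (coeff-+ₚ (p +ₚ q) r k) (+-congʳ (coeff-+ₚ p q k)) ⟩
    (coeff p k + coeff q k) + coeff r k   ≈⟨ +-assoc _ _ _ ⟩
    coeff p k + (coeff q k + coeff r k)   ≈⟨ trans (coeff-+ₚ p (q +ₚ r) k) (+-congˡ (coeff-+ₚ q r k)) ⟨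
    coeff (p +ₚ (q +ₚ r)) k               ∎
    where open import Relation.Binary.Reasoning.Setoid setoid

  +ₚ-comm : ∀ p q → p +ₚ q ≋ q +ₚ p
  +ₚ-comm p q = mk≋ λ k → trans (coeff-+ₚ p q k) (trans (+-comm _ _) (sym (coeff-+ₚ q p k)))

  +ₚ-identityʳ : ∀ p → p +ₚ [] ≋ p
  +ₚ-identityʳ p = mk≋ λ k → trans (coeff-+ₚ p [] k) (+-identityʳ _)

  -ₚ-inverseˡ : ∀ p → (-ₚ p) +ₚ p ≋ []
  -ₚ-inverseˡ p = mk≋ λ k → trans (coeff-+ₚ (-ₚ p) p k) (trans (+-congʳ (coeff-‿ₚ p k)) (-‿inverseˡ _))

  -ₚ-inverseʳ : ∀ p → p +ₚ (-ₚ p) ≋ []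
  -ₚ-inverseʳ p = ≋-trans (+ₚ-comm p (-ₚ p)) (-ₚ-inverseˡ p)

  +ₚ-interchange : ∀ p q r s → (p +ₚ q) +ₚ (r +ₚ s) ≋ (p +ₚ r) +ₚ (q +ₚ s)
  +ₚ-interchange p q r s = mk≋ λ k →
    trans (coeff-+ₚ (p +ₚ q) (r +ₚ s) k) (trans (+-cong (coeff-+ₚ p q k) (coeff-+ₚ r s k))
    (trans (interchange _ _ _ _)
    (sym (trans (coeff-+ₚ (p +ₚ r) (q +ₚ s) k) (+-cong (coeff-+ₚ p r k) (coeff-+ₚ q s k))))))

  ·ₚ-distribˡ : ∀ a p q → a ·ₚ (p +ₚ q) ≋ (a ·ₚ p) +ₚ (a ·ₚ q)
  ·ₚ-distribˡ a p q = mk≋ λ k →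
    trans (coeff-·ₚ a (p +ₚ q) k) (trans (*-congˡ (coeff-+ₚ p q k)) (trans (distribˡ _ _ _)
    (sym (trans (coeff-+ₚ (a ·ₚ p) (a ·ₚ q) k) (+-cong (coeff-·ₚ a p k) (coeff-·ₚ a q k))))))

  ·ₚ-distribʳ : ∀ a b p → (a + b) ·ₚ p ≋ (a ·ₚ p) +ₚ (b ·ₚ p)
  ·ₚ-distribʳ a b p = mk≋ λ k →
    trans (coeff-·ₚ (a + b) p k) (trans (distribʳ _ _ _)
    (sym (trans (coeff-+ₚ (a ·ₚ p) (b ·ₚ p) k) (+-cong (coeff-·ₚ a p k) (coeff-·ₚ b p k)))))

  ·ₚ-assoc : ∀ a b p → a ·ₚ (b ·ₚ p) ≋ (a * b) ·ₚ p
  ·ₚ-assoc a b p = mk≋ λ k →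
    trans (coeff-·ₚ a (b ·ₚ p) k) (trans (*-congˡ (coeff-·ₚ b p k))
    (trans (sym (*-assoc _ _ _)) (sym (coeff-·ₚ (a * b) p k))))

  ·ₚ-identity : ∀ p → 1# ·ₚ p ≋ p
  ·ₚ-identity p = mk≋ λ k → trans (coeff-·ₚ 1# p k) (*-identityˡ _)

  *ₚ-zeroˡ : ∀ p q → p ≋ [] → p *ₚ q ≋ []
  *ₚ-zeroˡ []      q p≋[] = ≋-refl
  *ₚ-zeroˡ (a ∷ p) q p≋[] =
    +ₚ-cong (·ₚ-zeroˡ q (at p≋[] zero)) (0∷-zero (*ₚ-zeroˡ p q (mk≋ (at p≋[] ∘ suc))))

  *ₚ-zeroʳ : ∀ p → p *ₚ [] ≋ []
  *ₚ-zeroʳ []      = ≋-refl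
  *ₚ-zeroʳ (a ∷ p) = 0∷-zero (*ₚ-zeroʳ p)

  *ₚ-congʳ : ∀ {p p'} q → p ≋ p' → p *ₚ q ≋ p' *ₚ q
  *ₚ-congʳ {[]}    {p'}     q p≋p' = ≋-sym (*ₚ-zeroˡ p' q (≋-sym p≋p'))
  *ₚ-congʳ {a ∷ p} {[]}     q p≋p' = *ₚ-zeroˡ (a ∷ p) q p≋p'
  *ₚ-congʳ {a ∷ p} {b ∷ p'} q p≋p' =
    +ₚ-cong (·ₚ-cong (at p≋p' zero) ≋-refl) (∷-cong refl (*ₚ-congʳ q (≋-tail p≋p')))

  *ₚ-congˡ : ∀ p {q q'} → q ≋ q' → p *ₚ q ≋ p *ₚ q'
  *ₚ-congˡ []      q≋q' = ≋-refl
  *ₚ-congˡ (a ∷ p) q≋q' = +ₚ-cong (·ₚ-cong refl q≋q') (∷-cong refl (*ₚ-congˡ p q≋q'))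

  *ₚ-cong : ∀ {p p' q q'} → p ≋ p' → q ≋ q' → p *ₚ q ≋ p' *ₚ q'
  *ₚ-cong {p} {p'} {q} p≋p' q≋q' = ≋-trans (*ₚ-congʳ q p≋p') (*ₚ-congˡ p' q≋q')

  0∷-+ₚ : ∀ p q → 0# ∷ (p +ₚ q) ≋ (0# ∷ p) +ₚ (0# ∷ q)
  0∷-+ₚ p q = ∷-cong (sym (+-identityʳ _)) ≋-refl

  *ₚ-distribʳ : ∀ q p p' → (p +ₚ p') *ₚ q ≋ (p *ₚ q) +ₚ (p' *ₚ q)
  *ₚ-distribʳ q []      p'       = ≋-refl
  *ₚ-distribʳ q (a ∷ p) []       = ≋-sym (+ₚ-identityʳ _)
  *ₚ-distribʳ q (a ∷ p) (b ∷ p') = ≋-trans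
    (+ₚ-cong (·ₚ-distribʳ a b q) (≋-trans (∷-cong refl (*ₚ-distribʳ q p p')) (0∷-+ₚ (p *ₚ q) (p' *ₚ q))))
    (+ₚ-interchange (a ·ₚ q) (b ·ₚ q) (0# ∷ (p *ₚ q)) (0# ∷ (p' *ₚ q)))

  *ₚ-distribˡ : ∀ p q q' → p *ₚ (q +ₚ q') ≋ (p *ₚ q) +ₚ (p *ₚ q')
  *ₚ-distribˡ []      q q' = ≋-refl
  *ₚ-distribˡ (a ∷ p) q q' = ≋-trans
    (+ₚ-cong (·ₚ-distribˡ a q q') (≋-trans (∷-cong refl (*ₚ-distribˡ p q q')) (0∷-+ₚ (p *ₚ q) (p *ₚ q'))))
    (+ₚ-interchange (a ·ₚ q) (a ·ₚ q') (0# ∷ (p *ₚ q)) (0# ∷ (p *ₚ q')))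

  ·ₚ-*ₚ-assoc : ∀ a q r → (a ·ₚ q) *ₚ r ≋ a ·ₚ (q *ₚ r)
  ·ₚ-*ₚ-assoc a []      r = ≋-refl
  ·ₚ-*ₚ-assoc a (b ∷ q) r = ≋-trans
    (+ₚ-cong (≋-sym (·ₚ-assoc a b r)) (∷-cong (sym (zeroʳ a)) (·ₚ-*ₚ-assoc a q r)))
    (≋-sym (·ₚ-distribˡ a (b ·ₚ r) (0# ∷ (q *ₚ r))))

  0∷-*ₚ : ∀ p r → (0# ∷ p) *ₚ r ≋ 0# ∷ (p *ₚ r)
  0∷-*ₚ p r = +ₚ-cong (·ₚ-zeroˡ r refl) ≋-refl

  *ₚ-assoc : ∀ p q r → (p *ₚ q) *ₚ r ≋ p *ₚ (q *ₚ r)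
  *ₚ-assoc []      q r = ≋-refl
  *ₚ-assoc (a ∷ p) q r = ≋-trans (*ₚ-distribʳ r (a ·ₚ q) (0# ∷ (p *ₚ q)))
    (+ₚ-cong (·ₚ-*ₚ-assoc a q r) (≋-trans (0∷-*ₚ (p *ₚ q) r) (∷-cong refl (*ₚ-assoc p q r))))

  *ₚ-∷ : ∀ p b q → p *ₚ (b ∷ q) ≋ (b ·ₚ p) +ₚ (0# ∷ (p *ₚ q))
  *ₚ-∷ []      b q = ≋-sym (0∷-zero ≋-refl)
  *ₚ-∷ (a ∷ p) b q = ∷-cong (+-congʳ (*-comm a b)) (≋-trans (+ₚ-cong ≋-refl (*ₚ-∷ p b q))
    (≋-trans (≋-sym (+ₚ-assoc (a ·ₚ q) (b ·ₚ p) _))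
    (≋-trans (+ₚ-cong (+ₚ-comm (a ·ₚ q) (b ·ₚ p)) ≋-refl) (+ₚ-assoc (b ·ₚ p) (a ·ₚ q) _))))

  *ₚ-comm : ∀ p q → p *ₚ q ≋ q *ₚ p
  *ₚ-comm []      q = ≋-sym (*ₚ-zeroʳ q)
  *ₚ-comm (a ∷ p) q = ≋-trans (+ₚ-cong ≋-refl (∷-cong refl (*ₚ-comm p q))) (≋-sym (*ₚ-∷ q a p))

  *ₚ-identityˡ : ∀ p → 1ₚ *ₚ p ≋ p
  *ₚ-identityˡ p = ≋-trans (+ₚ-cong (·ₚ-identity p) (0∷-zero ≋-refl)) (+ₚ-identityʳ p)

  polynomialRing : CommutativeRing c ℓ
  polynomialRing = record
    { Carrier = Pol ; _≈_ = _≋_ ; _+_ = _+ₚ_ ; _*_ = _*ₚ_ ; -_ = -ₚ_ ; 0# = [] ; 1# = 1ₚ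
    ; isCommutativeRing = record
      { isRing = record
        { +-isAbelianGroup = record
          { isGroup = record
            { isMonoid = record
              { isSemigroup = record
                { isMagma = record
                  { isEquivalence = record { refl = ≋-refl ; sym = ≋-sym ; trans = ≋-trans }
                  ; ∙-cong = +ₚ-cong }
                ; assoc = +ₚ-assoc }
              ; identity = (λ p → ≋-refl) , +ₚ-identityʳ }
            ; inverse = -ₚ-inverseˡ , -ₚ-inverseʳ
            ; ⁻¹-cong = -ₚ-cong }
          ; comm = +ₚ-comm }
        ; *-cong = *ₚ-cong
        ; *-assoc = *ₚ-assoc
        ; *-identity = *ₚ-identityˡ , (λ p → ≋-trans (*ₚ-comm p 1ₚ) (*ₚ-identityˡ p))
        ; distrib = *ₚ-distribˡ , *ₚ-distribʳ }
      ; *-comm = *ₚ-comm } }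

module Polynomials {c ℓ} (R : CommutativeRing c ℓ) where

  open CommutativeRing R hiding (zero)
  open Poly R
  open PolynomialRing R
  open import Data.List using ([]; _∷_)
  open import Data.Product using (∃; _,_)
  open import Function using (_∘_)
  open import Algebra.Properties.Group +-group using (ε⁻¹≈ε)
  open import Algebra.Properties.CommutativeSemigroup +-commutativeSemigroup using (interchange)
  module P = CommutativeRing polynomialRing
  open IntegerCoefficientSolver polynomialRing using (solve; _:=_; _:+_; _:*_; _:-_; :-_; con)
  open CommutativeRingDivisibility polynomialRing using (_∣_; _,_; Cancellable; ∣-+; ∣ʳ-respʳ-≈; x∣ʳy⇒x∣ʳzy)
  open import Algebra.Properties.Semiring.Exp P.semiring using (_^_)
  open import Function.Bundles using (_⇔_; mk⇔)
  open import Relation.Binary.Reasoning.Setoid P.setoid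

  const : Carrier → Pol
  const a = a ∷ []

  const-cong : ∀ {a b} → a ≈ b → const a ≋ const b
  const-cong a≈b = ∷-cong a≈b ≋-refl

  const-0 : const 0# ≋ []
  const-0 = 0∷-zero ≋-refl

  const-* : ∀ a b → const a *ₚ const b ≋ const (a * b)
  const-* a b = ∷-cong (+-identityʳ _) ≋-refl

  ·ₚ≋const*ₚ : ∀ a p → a ·ₚ p ≋ const a *ₚ p
  ·ₚ≋const*ₚ a p = ≋-sym (≋-trans (+ₚ-congˡ (a ·ₚ p) const-0) (+ₚ-identityʳ (a ·ₚ p)))

  t : Pol
  t = 0# ∷ 1# ∷ []

  t*ₚ : ∀ p → t *ₚ p ≋ 0# ∷ p
  t*ₚ p = +ₚ-cong (·ₚ-zeroˡ p refl) (∷-cong refl (*ₚ-identityˡ p))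

  ∷≋const+t* : ∀ a p → a ∷ p ≋ const a +ₚ (t *ₚ p)
  ∷≋const+t* a p = ≋-trans (∷-cong (sym (+-identityʳ a)) ≋-refl) (+ₚ-congˡ (const a) (≋-sym (t*ₚ p)))

  oneMinusT≋1-t : oneMinusT ≋ 1ₚ -ₚ t
  oneMinusT≋1-t = ∷-cong (sym (trans (+-congˡ ε⁻¹≈ε) (+-identityʳ _))) ≋-refl

  ev : Pol → Carrier
  ev []      = 0#
  ev (a ∷ p) = a + ev p

  ev-cong : ∀ {p q} → p ≋ q → ev p ≈ ev q
  ev-cong {[]}    {[]}    p≋q = refl
  ev-cong {[]}    {b ∷ q} p≋q =
    sym (trans (+-cong (sym (at p≋q zero)) (sym (ev-cong {[]} {q} (mk≋ (at p≋q ∘ suc))))) (+-identityʳ _))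
  ev-cong {a ∷ p} {[]}    p≋q =
    trans (+-cong (at p≋q zero) (ev-cong {p} {[]} (mk≋ (at p≋q ∘ suc)))) (+-identityʳ _)
  ev-cong {a ∷ p} {b ∷ q} p≋q = +-cong (at p≋q zero) (ev-cong (≋-tail p≋q))

  ev-+ₚ : ∀ p q → ev (p +ₚ q) ≈ ev p + ev q
  ev-+ₚ []      q       = sym (+-identityˡ _)
  ev-+ₚ (a ∷ p) []      = sym (+-identityʳ _)
  ev-+ₚ (a ∷ p) (b ∷ q) = trans (+-congˡ (ev-+ₚ p q)) (interchange a b (ev p) (ev q))

  ev-·ₚ : ∀ a p → ev (a ·ₚ p) ≈ a * ev p
  ev-·ₚ a []      = sym (zeroʳ a)
  ev-·ₚ a (b ∷ p) = trans (+-congˡ (ev-·ₚ a p)) (sym (distribˡ _ _ _))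

  ev-*ₚ : ∀ p q → ev (p *ₚ q) ≈ ev p * ev q
  ev-*ₚ []      q = sym (zeroˡ _)
  ev-*ₚ (a ∷ p) q = trans (ev-+ₚ (a ·ₚ q) (0# ∷ (p *ₚ q)))
    (trans (+-cong (ev-·ₚ a q) (trans (+-identityˡ _) (ev-*ₚ p q))) (sym (distribʳ _ _ _)))

  ev-oneMinusT : ev oneMinusT ≈ 0#
  ev-oneMinusT = trans (+-congˡ (+-identityʳ _)) (-‿inverseʳ _)

  oneMinusT∣⇒ev≈0 : ∀ {p} → oneMinusT ∣ p → ev p ≈ 0#
  oneMinusT∣⇒ev≈0 {p} (q , q[1-t]≋p) =
    trans (sym (ev-cong q[1-t]≋p)) (trans (ev-*ₚ q oneMinusT) (trans (*-congˡ ev-oneMinusT) (zeroʳ _)))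

  p≋ev+q[1-t] : ∀ p → ∃ λ q → p ≋ const (ev p) +ₚ (q *ₚ oneMinusT)
  p≋ev+q[1-t] []      = [] , ≋-sym const-0
  p≋ev+q[1-t] (a ∷ p) with p≋ev+q[1-t] p
  ... | q , p≋ev+q[1-t]ₚ = (-ₚ const (ev p)) +ₚ (t *ₚ q) , (begin
    a ∷ p
      ≈⟨ ∷≋const+t* a p ⟩
    const a +ₚ (t *ₚ p)
      ≈⟨ +ₚ-congˡ (const a) (*ₚ-congˡ t (≋-trans p≋ev+q[1-t]ₚ (+ₚ-congˡ (const (ev p)) (*ₚ-congˡ q oneMinusT≋1-t)))) ⟩
    const a +ₚ (t *ₚ (const (ev p) +ₚ (q *ₚ (1ₚ -ₚ t))))
      ≈⟨ solve 4 (λ A E Q T → A :+ T :* (E :+ Q :* (con (ℤ.+ 1) :- T))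
                            := (A :+ E) :+ ((:- E) :+ T :* Q) :* (con (ℤ.+ 1) :- T))
                 P.refl (const a) (const (ev p)) q t ⟩
    (const a +ₚ const (ev p)) +ₚ (((-ₚ const (ev p)) +ₚ (t *ₚ q)) *ₚ (1ₚ -ₚ t))
      ≈⟨ +ₚ-congˡ (const (a + ev p)) (*ₚ-congˡ ((-ₚ const (ev p)) +ₚ (t *ₚ q)) (≋-sym oneMinusT≋1-t)) ⟩
    const (a + ev p) +ₚ (((-ₚ const (ev p)) +ₚ (t *ₚ q)) *ₚ oneMinusT) ∎)

  oneMinusT∣1-b*p : ∀ {b} p → b * ev p ≈ 1# → oneMinusT ∣ (1ₚ -ₚ (const b *ₚ p))
  oneMinusT∣1-b*p {b} p b*evp≈1 with p≋ev+q[1-t] p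
  ... | q , p≋ev+q[1-t]ₚ = -ₚ (const b *ₚ q) , ≋-sym (begin
    1ₚ -ₚ (const b *ₚ p)
      ≈⟨ +ₚ-congˡ 1ₚ (-ₚ-cong (*ₚ-congˡ (const b) p≋ev+q[1-t]ₚ)) ⟩
    1ₚ -ₚ (const b *ₚ (const (ev p) +ₚ (q *ₚ oneMinusT)))
      ≈⟨ solve 4 (λ C E Q U → con (ℤ.+ 1) :- C :* (E :+ Q :* U) := (con (ℤ.+ 1) :- C :* E) :+ (:- (C :* Q)) :* U)
                 P.refl (const b) (const (ev p)) q oneMinusT ⟩
    (1ₚ -ₚ (const b *ₚ const (ev p))) +ₚ ((-ₚ (const b *ₚ q)) *ₚ oneMinusT)
      ≈⟨ +ₚ-congʳ ((-ₚ (const b *ₚ q)) *ₚ oneMinusT) (+ₚ-congˡ 1ₚ (-ₚ-cong (≋-trans (const-* b (ev p)) (const-cong b*evp≈1)))) ⟩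
    (1ₚ -ₚ 1ₚ) +ₚ ((-ₚ (const b *ₚ q)) *ₚ oneMinusT)
      ≈⟨ +ₚ-congʳ ((-ₚ (const b *ₚ q)) *ₚ oneMinusT) (-ₚ-inverseʳ 1ₚ) ⟩
    (-ₚ (const b *ₚ q)) *ₚ oneMinusT ∎)

  oneMinusT*ₚ≋ : ∀ p → oneMinusT *ₚ p ≋ p -ₚ (0# ∷ p)
  oneMinusT*ₚ≋ p = ≋-trans (*ₚ-congʳ p oneMinusT≋1-t)
    (≋-trans (solve 2 (λ T p → (con (ℤ.+ 1) :- T) :* p := p :- T :* p) P.refl t p)
             (+ₚ-congˡ p (-ₚ-cong (t*ₚ p))))

  oneMinusT*ₚ≋[]⇒≋[] : ∀ {p} → oneMinusT *ₚ p ≋ [] → p ≋ []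
  oneMinusT*ₚ≋[]⇒≋[] {p} [1-t]p≋[] = mk≋ coeff≈0
    where
      open import Algebra.Properties.Group +-group using (x∙y⁻¹≈ε⇒x≈y)
      coeff-shift : ∀ k → coeff p k - coeff (0# ∷ p) k ≈ 0#
      coeff-shift k = trans (sym (trans (coeff-+ₚ p _ k) (+-congˡ (coeff-‿ₚ (0# ∷ p) k))))
                            (at (≋-trans (≋-sym (oneMinusT*ₚ≋ p)) [1-t]p≋[]) k)
      coeff≈0 : ∀ k → coeff p k ≈ 0#
      coeff≈0 zero    = x∙y⁻¹≈ε⇒x≈y _ _ (coeff-shift zero)
      coeff≈0 (suc k) = trans (x∙y⁻¹≈ε⇒x≈y _ _ (coeff-shift (suc k))) (coeff≈0 k)

  oneMinusT-cancellable : Cancellable oneMinusT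
  oneMinusT-cancellable {p} {q} [1-t]p≋[1-t]q = x∙y⁻¹≈ε⇒x≈y p q (oneMinusT*ₚ≋[]⇒≋[] (begin
    oneMinusT *ₚ (p -ₚ q)                     ≈⟨ P.distribˡ oneMinusT p (-ₚ q) ⟩
    (oneMinusT *ₚ p) +ₚ (oneMinusT *ₚ (-ₚ q)) ≈⟨ +ₚ-congˡ (oneMinusT *ₚ p) (≋-sym (-‿distribʳ-* oneMinusT q)) ⟩
    (oneMinusT *ₚ p) -ₚ (oneMinusT *ₚ q)     ≈⟨ x≈y⇒x∙y⁻¹≈ε [1-t]p≋[1-t]q ⟩
    []                                        ∎))
    where open import Algebra.Properties.Group P.+-group using (x∙y⁻¹≈ε⇒x≈y; x≈y⇒x∙y⁻¹≈ε)
          open import Algebra.Properties.Ring P.ring using (-‿distribʳ-*)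

  qInt-suc : ∀ j → qInt (suc j) ≋ 1ₚ +ₚ (t *ₚ qInt j)
  qInt-suc j = ∷≋const+t* 1# (qInt j)

  ev-qInt : ∀ j → ev (qInt j) ≈ natToR R j
  ev-qInt zero    = refl
  ev-qInt (suc j) = +-congˡ (ev-qInt j)

  oneMinusT*qInt : ∀ j → oneMinusT *ₚ qInt j ≋ 1ₚ -ₚ (t ^ j)
  oneMinusT*qInt zero    = ≋-trans (*ₚ-zeroʳ oneMinusT) (≋-sym (-ₚ-inverseʳ 1ₚ))
  oneMinusT*qInt (suc j) = begin
    oneMinusT *ₚ qInt (suc j)                  ≈⟨ *ₚ-congˡ oneMinusT (qInt-suc j) ⟩
    oneMinusT *ₚ (1ₚ +ₚ (t *ₚ qInt j))         ≈⟨ solve 3 (λ U T Q → U :* (con (ℤ.+ 1) :+ T :* Q) := U :+ T :* (U :* Q)) P.refl oneMinusT t (qInt j) ⟩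
    oneMinusT +ₚ (t *ₚ (oneMinusT *ₚ qInt j))  ≈⟨ +ₚ-cong oneMinusT≋1-t (*ₚ-congˡ t (oneMinusT*qInt j)) ⟩
    (1ₚ -ₚ t) +ₚ (t *ₚ (1ₚ -ₚ (t ^ j)))        ≈⟨ solve 2 (λ T V → (con (ℤ.+ 1) :- T) :+ T :* (con (ℤ.+ 1) :- V) := con (ℤ.+ 1) :- T :* V) P.refl t (t ^ j) ⟩
    1ₚ -ₚ (t ^ suc j)                          ∎

  telescope : ∀ {M} (G : ℕ → Pol) →
    (∀ r → M ∣ ((G (suc (suc r)) -ₚ G (suc r)) -ₚ (t *ₚ (G (suc r) -ₚ G r)))) →
    ∀ j a → M ∣ ((G (a ℕ.+ j) -ₚ G a) -ₚ (qInt j *ₚ (G (suc a) -ₚ G a)))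
  telescope G step zero a = ∣ʳ-respʳ-≈ (begin
    []                            ≈⟨ solve 1 (λ x → con (ℤ.+ 0) := (x :- x) :- con (ℤ.+ 0)) P.refl (G a) ⟩
    (G a -ₚ G a) -ₚ []            ≡⟨ ≡.cong (λ i → (G i -ₚ G a) -ₚ []) (ℕ.+-identityʳ a) ⟨
    (G (a ℕ.+ 0) -ₚ G a) -ₚ []    ∎) ([] , ≋-refl)
  telescope G step (suc j) a = ∣ʳ-respʳ-≈ (begin
    ((G (suc a ℕ.+ j) -ₚ G (suc a)) -ₚ (qInt j *ₚ Δ (suc a))) +ₚ (qInt j *ₚ (Δ (suc a) -ₚ (t *ₚ Δ a)))
      ≈⟨ solve 6 (λ Gaj Ga1 Ga Q T Y → ((Gaj :- Ga1) :- Q :* Y) :+ Q :* (Y :- T :* (Ga1 :- Ga))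
                                      := (Gaj :- Ga) :- (con (ℤ.+ 1) :+ T :* Q) :* (Ga1 :- Ga))
                 P.refl (G (suc a ℕ.+ j)) (G (suc a)) (G a) (qInt j) t (Δ (suc a)) ⟩
    (G (suc a ℕ.+ j) -ₚ G a) -ₚ ((1ₚ +ₚ (t *ₚ qInt j)) *ₚ Δ a)
      ≈⟨ +ₚ-cong (≋-reflexive (≡.cong (λ i → G i -ₚ G a) (ℕ.+-suc a j))) (-ₚ-cong (*ₚ-congʳ (Δ a) (qInt-suc j))) ⟨
    (G (a ℕ.+ suc j) -ₚ G a) -ₚ (qInt (suc j) *ₚ Δ a) ∎)
    (∣-+ (telescope G step j (suc a)) (x∣ʳy⇒x∣ʳzy (qInt j) (step a)))
    where
      Δ : ℕ → Pol
      Δ r = G (suc r) -ₚ G r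

  ^ₚ≡^ : ∀ p k → p ^ₚ k ≡ p ^ k
  ^ₚ≡^ p zero    = ≡.refl
  ^ₚ≡^ p (suc k) = ≡.cong (p *ₚ_) (^ₚ≡^ p k)

  ^ₚ∣ₚ⇔^∣ : ∀ p k {x} → (p ^ₚ k) ∣ₚ x ⇔ p ^ k ∣ x
  ^ₚ∣ₚ⇔^∣ p k {x} = ≡.subst (λ d → (p ^ₚ k) ∣ₚ x ⇔ d ∣ x) (^ₚ≡^ p k) (mk⇔ ∣ₚ⇒∣ ∣⇒∣ₚ)
    where
      ∣ₚ⇒∣ : ∀ {d} → d ∣ₚ x → d ∣ x
      ∣ₚ⇒∣ (q , x≈q*d) = q , ≋-sym (mk≋ x≈q*d)
      ∣⇒∣ₚ : ∀ {d} → d ∣ x → d ∣ₚ x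
      ∣⇒∣ₚ (q , q*d≋x) = q , at (≋-sym q*d≋x)

module ResidueParts {c ℓ} (R : CommutativeRing c ℓ) (n' : ℕ) where

  open CommutativeRing R hiding (zero)
  open Poly R
  open PolynomialRing R
  open Polynomials R
  open import Data.List using ([]; _∷_)
  open import Data.Product using (∃; _,_)
  open import Data.Empty using (⊥-elim)
  open import Function using (_∘_)
  open import Data.Nat.DivMod using (%-distribˡ-+; [m+n]%n≡m%n; m%n<n; m<n⇒m%n≡m; %-pred-≡0)
  open import Relation.Nullary using (¬_; yes; no)
  open import Algebra.Properties.Group +-group using (ε⁻¹≈ε)
  open import Algebra.Properties.Semiring.Exp P.semiring using (_^_)
  open IntegerCoefficientSolver polynomialRing using (solve; _:=_; _:+_; _:*_; _:-_; con)
  open CommutativeRingDivisibility polynomialRing using (_∣_; _,_; ∣-+; ∣ʳ-respʳ-≈)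
  open import Relation.Binary.Reasoning.Setoid P.setoid

  n : ℕ
  n = suc n'

  m%n≡o%n⇒[1+m]%n≡[1+o]%n : ∀ m o → m % n ≡ o % n → suc m % n ≡ suc o % n
  m%n≡o%n⇒[1+m]%n≡[1+o]%n m o eq =
    ≡.trans (%-distribˡ-+ 1 m n) (≡.trans (≡.cong (λ x → (1 % n ℕ.+ x) % n) eq) (≡.sym (%-distribˡ-+ 1 o n)))

  [1+m]%n≡[1+o]%n⇒m%n≡o%n : ∀ m o → suc m % n ≡ suc o % n → m % n ≡ o % n
  [1+m]%n≡[1+o]%n⇒m%n≡o%n m o eq = ≡.trans (back m) (≡.trans (≡.cong (λ x → (x ℕ.+ n' % n) % n) eq) (≡.sym (back o)))
    where
      back : ∀ m → m % n ≡ ((suc m % n) ℕ.+ (n' % n)) % n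
      back m = ≡.trans (≡.sym ([m+n]%n≡m%n m n)) (≡.trans (≡.cong (_% n) (ℕ.+-suc m n')) (%-distribˡ-+ (suc m) n' n))

  [1+r+n']%n≡r%n : ∀ r → suc (r ℕ.+ n') % n ≡ r % n
  [1+r+n']%n≡r%n r = ≡.trans (≡.cong (_% n) (≡.sym (ℕ.+-suc r n'))) ([m+n]%n≡m%n r n)

  coeff-residuePartFrom-suc : ∀ r j a p k →
    coeff (residuePartFrom n r j (a ∷ p)) (suc k) ≡ coeff (residuePartFrom n r (suc j) p) k
  coeff-residuePartFrom-suc r j a p k with j % n ℕ.≟ r
  ... | yes _ = ≡.refl
  ... | no  _ = ≡.refl

  coeff-residuePartFrom-∈ : ∀ r j p k → (j ℕ.+ k) % n ≡ r → coeff (residuePartFrom n r j p) k ≈ coeff p k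
  coeff-residuePartFrom-∈ r j []      k       _  = refl
  coeff-residuePartFrom-∈ r j (a ∷ p) zero    eq with j % n ℕ.≟ r
  ... | yes _  = refl
  ... | no  ne = ⊥-elim (ne (≡.trans (≡.cong (_% n) (≡.sym (ℕ.+-identityʳ j))) eq))
  coeff-residuePartFrom-∈ r j (a ∷ p) (suc k) eq =
    trans (reflexive (coeff-residuePartFrom-suc r j a p k))
          (coeff-residuePartFrom-∈ r (suc j) p k (≡.trans (≡.cong (_% n) (≡.sym (ℕ.+-suc j k))) eq))

  coeff-residuePartFrom-∉ : ∀ r j p k → ¬ (j ℕ.+ k) % n ≡ r → coeff (residuePartFrom n r j p) k ≈ 0#
  coeff-residuePartFrom-∉ r j []      k       _  = refl
  coeff-residuePartFrom-∉ r j (a ∷ p) zero    ne with j % n ℕ.≟ r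
  ... | yes eq = ⊥-elim (ne (≡.trans (≡.cong (_% n) (ℕ.+-identityʳ j)) eq))
  ... | no  _  = refl
  coeff-residuePartFrom-∉ r j (a ∷ p) (suc k) ne =
    trans (reflexive (coeff-residuePartFrom-suc r j a p k))
          (coeff-residuePartFrom-∉ r (suc j) p k (ne ∘ ≡.trans (≡.cong (_% n) (ℕ.+-suc j k))))

  coeff-residuePart-∈ : ∀ r p k → k % n ≡ r → coeff (residuePart n r p) k ≈ coeff p k
  coeff-residuePart-∈ r = coeff-residuePartFrom-∈ r 0

  coeff-residuePart-∉ : ∀ r p k → ¬ k % n ≡ r → coeff (residuePart n r p) k ≈ 0#
  coeff-residuePart-∉ r = coeff-residuePartFrom-∉ r 0

  part : ℕ → Pol → Pol
  part r = residuePart n (r % n)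

  part-≡ : ∀ a b → a % n ≡ b % n → ∀ p → part a p ≡ part b p
  part-≡ a b eq p = ≡.cong (λ i → residuePart n i p) eq

  part-cong : ∀ r {p q} → p ≋ q → part r p ≋ part r q
  part-cong r {p} {q} p≋q = mk≋ λ k → case k
    where
      case : ∀ k → coeff (part r p) k ≈ coeff (part r q) k
      case k with k % n ℕ.≟ r % n
      ... | yes eq = trans (coeff-residuePart-∈ _ p k eq) (trans (at p≋q k) (sym (coeff-residuePart-∈ _ q k eq)))
      ... | no  ne = trans (coeff-residuePart-∉ _ p k ne) (sym (coeff-residuePart-∉ _ q k ne))

  part-+ₚ : ∀ r p q → part r (p +ₚ q) ≋ part r p +ₚ part r q
  part-+ₚ r p q = mk≋ λ k → trans (case k) (sym (coeff-+ₚ (part r p) (part r q) k))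
    where
      case : ∀ k → coeff (part r (p +ₚ q)) k ≈ coeff (part r p) k + coeff (part r q) k
      case k with k % n ℕ.≟ r % n
      ... | yes eq = trans (coeff-residuePart-∈ _ (p +ₚ q) k eq) (trans (coeff-+ₚ p q k)
                       (sym (+-cong (coeff-residuePart-∈ _ p k eq) (coeff-residuePart-∈ _ q k eq))))
      ... | no  ne = trans (coeff-residuePart-∉ _ (p +ₚ q) k ne)
                       (sym (trans (+-cong (coeff-residuePart-∉ _ p k ne) (coeff-residuePart-∉ _ q k ne)) (+-identityʳ 0#)))

  part-‿ₚ : ∀ r p → part r (-ₚ p) ≋ -ₚ part r p
  part-‿ₚ r p = mk≋ λ k → trans (case k) (sym (coeff-‿ₚ (part r p) k))
    where
      case : ∀ k → coeff (part r (-ₚ p)) k ≈ - coeff (part r p) k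
      case k with k % n ℕ.≟ r % n
      ... | yes eq = trans (coeff-residuePart-∈ _ (-ₚ p) k eq) (trans (coeff-‿ₚ p k) (-‿cong (sym (coeff-residuePart-∈ _ p k eq))))
      ... | no  ne = trans (coeff-residuePart-∉ _ (-ₚ p) k ne) (sym (trans (-‿cong (coeff-residuePart-∉ _ p k ne)) ε⁻¹≈ε))

  part--ₚ : ∀ r p q → part r (p -ₚ q) ≋ part r p -ₚ part r q
  part--ₚ r p q = ≋-trans (part-+ₚ r p (-ₚ q)) (+ₚ-congˡ (part r p) (part-‿ₚ r q))

  part-shift : ∀ r p → part (suc r) (t *ₚ p) ≋ t *ₚ part r p
  part-shift r p = ≋-trans (part-cong (suc r) (t*ₚ p)) (≋-trans (mk≋ case) (≋-sym (t*ₚ (part r p))))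
    where
      case : ∀ k → coeff (part (suc r) (0# ∷ p)) k ≈ coeff (0# ∷ part r p) k
      case zero with 0 % n ℕ.≟ suc r % n
      ... | yes _ = refl
      ... | no  _ = refl
      case (suc k) with k % n ℕ.≟ r % n
      ... | yes eq = trans (coeff-residuePart-∈ _ (0# ∷ p) (suc k) (m%n≡o%n⇒[1+m]%n≡[1+o]%n k r eq))
                           (sym (coeff-residuePart-∈ _ p k eq))
      ... | no  ne = trans (coeff-residuePart-∉ _ (0# ∷ p) (suc k) (ne ∘ [1+m]%n≡[1+o]%n⇒m%n≡o%n k r))
                           (sym (coeff-residuePart-∉ _ p k ne))

  part-t^ : ∀ j r p → part (j ℕ.+ r) ((t ^ j) *ₚ p) ≋ (t ^ j) *ₚ part r p
  part-t^ zero    r p = ≋-trans (part-cong r (*ₚ-identityˡ p)) (≋-sym (*ₚ-identityˡ (part r p)))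
  part-t^ (suc j) r p = begin
    part (suc (j ℕ.+ r)) ((t *ₚ (t ^ j)) *ₚ p)  ≈⟨ part-cong (suc (j ℕ.+ r)) (*ₚ-assoc t (t ^ j) p) ⟩
    part (suc (j ℕ.+ r)) (t *ₚ ((t ^ j) *ₚ p))  ≈⟨ part-shift (j ℕ.+ r) ((t ^ j) *ₚ p) ⟩
    t *ₚ part (j ℕ.+ r) ((t ^ j) *ₚ p)          ≈⟨ *ₚ-congˡ t (part-t^ j r p) ⟩
    t *ₚ ((t ^ j) *ₚ part r p)                  ≈⟨ *ₚ-assoc t (t ^ j) (part r p) ⟨
    (t *ₚ (t ^ j)) *ₚ part r p                  ∎

  part-tⁿ : ∀ r p → part r ((t ^ n) *ₚ p) ≋ (t ^ n) *ₚ part r p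
  part-tⁿ r p = ≡.subst (_≋ (t ^ n) *ₚ part r p) (part-≡ (n ℕ.+ r) r [n+m]%n≡m%n ((t ^ n) *ₚ p)) (part-t^ n r p)
    where
      [n+m]%n≡m%n : (n ℕ.+ r) % n ≡ r % n
      [n+m]%n≡m%n = ≡.trans (≡.cong (_% n) (ℕ.+-comm n r)) ([m+n]%n≡m%n r n)

  1-tⁿ : Pol
  1-tⁿ = 1ₚ -ₚ (t ^ n)

  part-oneMinusT* : ∀ r g → part (suc r) (oneMinusT *ₚ g) ≋ part (suc r) g -ₚ (t *ₚ part r g)
  part-oneMinusT* r g = begin
    part (suc r) (oneMinusT *ₚ g)               ≈⟨ part-cong (suc r) (oneMinusT*ₚ≋ g) ⟩
    part (suc r) (g -ₚ (0# ∷ g))                ≈⟨ part--ₚ (suc r) g (0# ∷ g) ⟩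
    part (suc r) g -ₚ part (suc r) (0# ∷ g)     ≈⟨ +ₚ-congˡ (part (suc r) g) (-ₚ-cong (part-cong (suc r) (≋-sym (t*ₚ g)))) ⟩
    part (suc r) g -ₚ part (suc r) (t *ₚ g)     ≈⟨ +ₚ-congˡ (part (suc r) g) (-ₚ-cong (part-shift r g)) ⟩
    part (suc r) g -ₚ (t *ₚ part r g)           ∎

  part-1-tⁿ* : ∀ r g → part r (1-tⁿ *ₚ g) ≋ 1-tⁿ *ₚ part r g
  part-1-tⁿ* r g = begin
    part r (1-tⁿ *ₚ g)                        ≈⟨ part-cong r (solve 2 (λ V g → (con (ℤ.+ 1) :- V) :* g := g :- V :* g) P.refl (t ^ n) g) ⟩
    part r (g -ₚ ((t ^ n) *ₚ g))              ≈⟨ part--ₚ r g ((t ^ n) *ₚ g) ⟩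
    part r g -ₚ part r ((t ^ n) *ₚ g)         ≈⟨ +ₚ-congˡ (part r g) (-ₚ-cong (part-tⁿ r g)) ⟩
    part r g -ₚ ((t ^ n) *ₚ part r g)         ≈⟨ solve 2 (λ V h → h :- V :* h := (con (ℤ.+ 1) :- V) :* h) P.refl (t ^ n) (part r g) ⟩
    1-tⁿ *ₚ part r g                          ∎

  partsBelow : ℕ → Pol → Pol
  partsBelow zero    p = []
  partsBelow (suc j) p = residuePart n j p +ₚ partsBelow j p

  coeff-partsBelow-≥ : ∀ j p k → j ℕ.≤ k % n → coeff (partsBelow j p) k ≈ 0#
  coeff-partsBelow-≥ zero    p k _   = refl
  coeff-partsBelow-≥ (suc j) p k j<k = trans (coeff-+ₚ (residuePart n j p) (partsBelow j p) k)
    (trans (+-cong (coeff-residuePart-∉ j p k (λ eq → ℕ.<-irrefl (≡.sym eq) j<k))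
                   (coeff-partsBelow-≥ j p k (ℕ.<⇒≤ j<k)))
           (+-identityʳ 0#))

  coeff-partsBelow-< : ∀ j p k → k % n ℕ.< j → coeff (partsBelow j p) k ≈ coeff p k
  coeff-partsBelow-< (suc j) p k k<1+j with k % n ℕ.≟ j
  ... | yes eq = trans (coeff-+ₚ (residuePart n j p) (partsBelow j p) k)
    (trans (+-cong (coeff-residuePart-∈ j p k eq) (coeff-partsBelow-≥ j p k (ℕ.≤-reflexive (≡.sym eq))))
           (+-identityʳ _))
  ... | no  ne = trans (coeff-+ₚ (residuePart n j p) (partsBelow j p) k)
    (trans (+-cong (coeff-residuePart-∉ j p k ne) (coeff-partsBelow-< j p k (ℕ.≤∧≢⇒< (ℕ.m<1+n⇒m≤n k<1+j) ne)))
           (+-identityˡ _))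

  partsBelow-n : ∀ p → partsBelow n p ≋ p
  partsBelow-n p = mk≋ λ k → coeff-partsBelow-< n p k (m%n<n k n)

  SupportedOn : ℕ → Pol → Set ℓ
  SupportedOn r p = ∀ k → ¬ k % n ≡ r % n → coeff p k ≈ 0#

  part-supportedOn : ∀ r p → SupportedOn r (part r p)
  part-supportedOn r p = coeff-residuePart-∉ (r % n) p

  -- r + n' is r - 1 modulo n, without truncated subtraction.
  SupportedOn-tail : ∀ r a p → SupportedOn r (a ∷ p) → SupportedOn (r ℕ.+ n') p
  SupportedOn-tail r a p sup k ne =
    sup (suc k) (ne ∘ λ eq → [1+m]%n≡[1+o]%n⇒m%n≡o%n k (r ℕ.+ n') (≡.trans eq (≡.sym ([1+r+n']%n≡r%n r))))

  supportedOn⇒≋ev*t^+q*[1-tⁿ] : ∀ r p → SupportedOn r p →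
    ∃ λ q → p ≋ (const (ev p) *ₚ (t ^ (r % n))) +ₚ (q *ₚ 1-tⁿ)
  supportedOn⇒≋ev*t^+q*[1-tⁿ] r [] sup =
    [] , ≋-sym (≋-trans (+ₚ-identityʳ _) (*ₚ-zeroˡ (const 0#) (t ^ (r % n)) const-0))
  supportedOn⇒≋ev*t^+q*[1-tⁿ] r (a ∷ p) sup
    with supportedOn⇒≋ev*t^+q*[1-tⁿ] (r ℕ.+ n') p (SupportedOn-tail r a p sup) | r % n in r%n≡
  ... | q , p≋ | zero = (t *ₚ q) -ₚ const (ev p) , (begin
    a ∷ p
      ≈⟨ ∷≋const+t* a p ⟩
    const a +ₚ (t *ₚ p)
      ≈⟨ +ₚ-congˡ (const a) (*ₚ-congˡ t (≡.subst (λ i → p ≋ ((const (ev p) *ₚ (t ^ i)) +ₚ (q *ₚ 1-tⁿ))) [r+n']%n≡n' p≋)) ⟩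
    const a +ₚ (t *ₚ ((const (ev p) *ₚ (t ^ n')) +ₚ (q *ₚ 1-tⁿ)))
      ≈⟨ solve 5 (λ A E Q T V → A :+ T :* (E :* V :+ Q :* (con (ℤ.+ 1) :- T :* V))
                              := (A :+ E) :* con (ℤ.+ 1) :+ (T :* Q :- E) :* (con (ℤ.+ 1) :- T :* V))
                 P.refl (const a) (const (ev p)) q t (t ^ n') ⟩
    (const (a + ev p) *ₚ 1ₚ) +ₚ (((t *ₚ q) -ₚ const (ev p)) *ₚ 1-tⁿ) ∎)
    where
      [r+n']%n≡n' : (r ℕ.+ n') % n ≡ n'
      [r+n']%n≡n' = %-pred-≡0 (≡.trans ([1+r+n']%n≡r%n r) r%n≡)
  ... | q , p≋ | suc i = t *ₚ q , (begin
    a ∷ p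
      ≈⟨ ∷≋const+t* a p ⟩
    const a +ₚ (t *ₚ p)
      ≈⟨ +ₚ-cong (≋-trans (const-cong a≈0) const-0) (*ₚ-congˡ t (≡.subst (λ j → p ≋ ((const (ev p) *ₚ (t ^ j)) +ₚ (q *ₚ 1-tⁿ))) [r+n']%n≡i p≋)) ⟩
    [] +ₚ (t *ₚ ((const (ev p) *ₚ (t ^ i)) +ₚ (q *ₚ 1-tⁿ)))
      ≈⟨ solve 5 (λ E Q T V X → con (ℤ.+ 0) :+ T :* (E :* V :+ Q :* X) := E :* (T :* V) :+ (T :* Q) :* X)
                 P.refl (const (ev p)) q t (t ^ i) 1-tⁿ ⟩
    (const (ev p) *ₚ (t ^ suc i)) +ₚ ((t *ₚ q) *ₚ 1-tⁿ)
      ≈⟨ +ₚ-congʳ ((t *ₚ q) *ₚ 1-tⁿ) (*ₚ-congʳ (t ^ suc i) (const-cong (trans (+-congʳ a≈0) (+-identityˡ _)))) ⟨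
    (const (a + ev p) *ₚ (t ^ suc i)) +ₚ ((t *ₚ q) *ₚ 1-tⁿ) ∎)
    where
      a≈0 : a ≈ 0#
      a≈0 = sup 0 (λ eq → ℕ.0≢1+n (≡.trans eq r%n≡))
      1+i<n : suc i ℕ.< n
      1+i<n = ≡.subst (ℕ._< n) r%n≡ (m%n<n r n)
      [r+n']%n≡i : (r ℕ.+ n') % n ≡ i
      [r+n']%n≡i = ≡.trans
        ([1+m]%n≡[1+o]%n⇒m%n≡o%n (r ℕ.+ n') i
          (≡.trans ([1+r+n']%n≡r%n r) (≡.trans r%n≡ (≡.sym (m<n⇒m%n≡m 1+i<n)))))
        (m<n⇒m%n≡m (ℕ.<⇒≤ 1+i<n))

  supportedOn∧ev≈0⇒1-tⁿ∣ : ∀ r p → SupportedOn r p → ev p ≈ 0# → 1-tⁿ ∣ p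
  supportedOn∧ev≈0⇒1-tⁿ∣ r p sup ev≈0 with supportedOn⇒≋ev*t^+q*[1-tⁿ] r p sup
  ... | q , p≋ = q , ≋-sym (≋-trans p≋
    (+ₚ-congʳ (q *ₚ 1-tⁿ) (*ₚ-zeroˡ (const (ev p)) (t ^ (r % n)) (≋-trans (const-cong ev≈0) const-0))))

  ∣parts⇒∣ : ∀ {M} p → (∀ j → M ∣ part j p) → M ∣ p
  ∣parts⇒∣ {M} p M∣part = ∣ʳ-respʳ-≈ (partsBelow-n p) (M∣partsBelow n ℕ.≤-refl)
    where
      M∣partsBelow : ∀ j → j ℕ.≤ n → M ∣ partsBelow j p
      M∣partsBelow zero    _     = [] , ≋-refl
      M∣partsBelow (suc j) 1+j≤n =
        ∣-+ (≡.subst (λ i → M ∣ residuePart n i p) (m<n⇒m%n≡m 1+j≤n) (M∣part j)) (M∣partsBelow j (ℕ.<⇒≤ 1+j≤n))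

module QIntegerPowers {c ℓ} (F : CharZeroField c ℓ) (n' : ℕ) where

  open CharZeroField F using (commutativeRing; inverseˡ; charZero)
  open CommutativeRing commutativeRing hiding (zero)
  open Poly commutativeRing
  open PolynomialRing commutativeRing
  open Polynomials commutativeRing
  open ResidueParts commutativeRing n'
  open CommutativeRingDivisibility polynomialRing
    using (_∣_; _,_; ∣-+; ∣-‿; ∣--; ∣ʳ-trans; ∣ʳ-respʳ-≈; ∣ʳ-respˡ-≈; x∣ʳyx; x∣ʳy⇒x∣ʳzy; x∣y⇒zx∣zy; ^∣*-invertible⇒^∣; *∣*⇒∣)
  open import Algebra.Properties.Semiring.Exp P.semiring using (_^_)
  open IntegerCoefficientSolver polynomialRing using (solve; _:=_; _:+_; _:*_; _:-_; :-_; con)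
  open import Data.List using ([])
  open import Data.Product using (_,_)
  open import Data.Nat.DivMod using (m%n<n; m<n⇒m%n≡m; n%n≡0; [m+n]%n≡m%n)
  open import Data.Fin using (Fin; toℕ; fromℕ<)
  open import Data.Fin.Properties using (toℕ<n; toℕ-fromℕ<)
  open import Function.Bundles using (_⇔_; mk⇔; Equivalence)
  open import Function.Construct.Composition using (_⇔-∘_)
  open import Relation.Binary.Reasoning.Setoid P.setoid

  Φ : Pol
  Φ = qInt n

  u : Pol
  u = oneMinusT

  1-tⁿ≋uΦ : 1-tⁿ ≋ u *ₚ Φ
  1-tⁿ≋uΦ = ≋-sym (oneMinusT*qInt n)

  n⁻¹ : Carrier
  n⁻¹ = invNat F n

  n⁻¹*n≈1 : n⁻¹ * natToR commutativeRing n ≈ 1#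
  n⁻¹*n≈1 = inverseˡ (natToR commutativeRing n) (charZero n')

  u^∣Φ*⇒u^∣ : ∀ k {x} → u ^ k ∣ (Φ *ₚ x) → u ^ k ∣ x
  u^∣Φ*⇒u^∣ k = ^∣*-invertible⇒^∣ (const n⁻¹) k
    (oneMinusT∣1-b*p Φ (trans (*-congˡ (ev-qInt n)) n⁻¹*n≈1))

  Δ : Pol → ℕ → Pol
  Δ g r = part (suc r) g -ₚ part r g

  Balanced : ℕ → Pol → Set (c ⊔ ℓ)
  Balanced m g = ∀ r → u ^ m ∣ Δ g r

  Balanced-cong : ∀ m {g g'} → g ≋ g' → Balanced m g → Balanced m g'
  Balanced-cong m g≋g' bal r =
    ∣ʳ-respʳ-≈ (+ₚ-cong (part-cong (suc r) g≋g') (-ₚ-cong (part-cong r g≋g'))) (bal r)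

  part-Φ*-step : ∀ r f → part (suc r) (Φ *ₚ f) -ₚ (t *ₚ part r (Φ *ₚ f)) ≋ 1-tⁿ *ₚ part (suc r) f
  part-Φ*-step r f = begin
    part (suc r) (Φ *ₚ f) -ₚ (t *ₚ part r (Φ *ₚ f))  ≈⟨ part-oneMinusT* r (Φ *ₚ f) ⟨
    part (suc r) (u *ₚ (Φ *ₚ f))                      ≈⟨ part-cong (suc r) (≋-trans (≋-sym (*ₚ-assoc u Φ f)) (*ₚ-congʳ f (≋-sym 1-tⁿ≋uΦ))) ⟩
    part (suc r) (1-tⁿ *ₚ f)                          ≈⟨ part-1-tⁿ* (suc r) f ⟩
    1-tⁿ *ₚ part (suc r) f                            ∎

  Δ-Φ*-step : ∀ r f → (Δ (Φ *ₚ f) (suc r) -ₚ (t *ₚ Δ (Φ *ₚ f) r)) ≋ u *ₚ (Φ *ₚ Δ f (suc r))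
  Δ-Φ*-step r f = begin
    Δ (Φ *ₚ f) (suc r) -ₚ (t *ₚ Δ (Φ *ₚ f) r)
      ≈⟨ solve 4 (λ G₀ G₁ G₂ T → (G₂ :- G₁) :- T :* (G₁ :- G₀) := (G₂ :- T :* G₁) :- (G₁ :- T :* G₀))
                 P.refl (G r) (G (suc r)) (G (suc (suc r))) t ⟩
    (G (suc (suc r)) -ₚ (t *ₚ G (suc r))) -ₚ (G (suc r) -ₚ (t *ₚ G r))
      ≈⟨ +ₚ-cong (part-Φ*-step (suc r) f) (-ₚ-cong (part-Φ*-step r f)) ⟩
    (1-tⁿ *ₚ part (suc (suc r)) f) -ₚ (1-tⁿ *ₚ part (suc r) f)
      ≈⟨ +ₚ-cong (*ₚ-congʳ (part (suc (suc r)) f) 1-tⁿ≋uΦ) (-ₚ-cong (*ₚ-congʳ (part (suc r) f) 1-tⁿ≋uΦ)) ⟩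
    ((u *ₚ Φ) *ₚ part (suc (suc r)) f) -ₚ ((u *ₚ Φ) *ₚ part (suc r) f)
      ≈⟨ solve 4 (λ U Φ a b → (U :* Φ) :* a :- (U :* Φ) :* b := U :* (Φ :* (a :- b)))
                 P.refl u Φ (part (suc (suc r)) f) (part (suc r) f) ⟩
    u *ₚ (Φ *ₚ Δ f (suc r)) ∎
    where
      G : ℕ → Pol
      G a = part a (Φ *ₚ f)

  Balanced-Φ* : ∀ m f → Balanced m f → Balanced (suc m) (Φ *ₚ f)
  Balanced-Φ* m f bal r = u^∣Φ*⇒u^∣ (suc m) (∣ʳ-respʳ-≈ period (∣-‿ (telescope G step n r)))
    where
      G : ℕ → Pol
      G a = part a (Φ *ₚ f)
      step : ∀ a → u ^ suc m ∣ ((G (suc (suc a)) -ₚ G (suc a)) -ₚ (t *ₚ (G (suc a) -ₚ G a)))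
      step a = ∣ʳ-respʳ-≈ (≋-sym (Δ-Φ*-step a f)) (x∣y⇒zx∣zy u (x∣ʳy⇒x∣ʳzy Φ (bal (suc a))))
      period : -ₚ ((G (r ℕ.+ n) -ₚ G r) -ₚ (Φ *ₚ Δ (Φ *ₚ f) r)) ≋ Φ *ₚ Δ (Φ *ₚ f) r
      period = begin
        -ₚ ((G (r ℕ.+ n) -ₚ G r) -ₚ (Φ *ₚ Δ (Φ *ₚ f) r))
          ≡⟨ ≡.cong (λ X → -ₚ ((X -ₚ G r) -ₚ (Φ *ₚ Δ (Φ *ₚ f) r))) (part-≡ (r ℕ.+ n) r ([m+n]%n≡m%n r n) (Φ *ₚ f)) ⟩
        -ₚ ((G r -ₚ G r) -ₚ (Φ *ₚ Δ (Φ *ₚ f) r))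
          ≈⟨ solve 2 (λ x y → :- ((x :- x) :- y) := y) P.refl (G r) (Φ *ₚ Δ (Φ *ₚ f) r) ⟩
        Φ *ₚ Δ (Φ *ₚ f) r ∎

  Balanced-Φ*⁻¹ : ∀ m f → Balanced (suc m) (Φ *ₚ f) → Balanced m f
  Balanced-Φ*⁻¹ m f bal r = ≡.subst (λ X → u ^ m ∣ X) Δ-periodic
    (u^∣Φ*⇒u^∣ m (*∣*⇒∣ {u} {u ^ m} oneMinusT-cancellable
      (∣ʳ-respʳ-≈ (Δ-Φ*-step s f) (∣-- (bal (suc s)) (x∣ʳy⇒x∣ʳzy t (bal s))))))
    where
      s : ℕ
      s = r ℕ.+ n'
      Δ-periodic : Δ f (suc s) ≡ Δ f r
      Δ-periodic = ≡.cong₂ _-ₚ_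
        (part-≡ (suc (suc s)) (suc r) (m%n≡o%n⇒[1+m]%n≡[1+o]%n (suc s) r ([1+r+n']%n≡r%n r)) f)
        (part-≡ (suc s) r ([1+r+n']%n≡r%n r) f)

  Balanced-1⇒Φ∣ : ∀ g → Balanced 1 g → Φ ∣ g
  Balanced-1⇒Φ∣ g bal = *∣*⇒∣ {u} {Φ} oneMinusT-cancellable
    (∣ʳ-respˡ-≈ 1-tⁿ≋uΦ (∣parts⇒∣ (u *ₚ g) λ j →
      supportedOn∧ev≈0⇒1-tⁿ∣ j _ (part-supportedOn j (u *ₚ g)) (oneMinusT∣⇒ev≈0 (u∣part j))))
    where
      u∣part-suc : ∀ r → u ∣ part (suc r) (u *ₚ g)
      u∣part-suc r = ∣ʳ-respʳ-≈ (≋-sym (begin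
        part (suc r) (u *ₚ g)                 ≈⟨ part-oneMinusT* r g ⟩
        part (suc r) g -ₚ (t *ₚ part r g)     ≈⟨ solve 3 (λ G₁ G₀ T → G₁ :- T :* G₀ := (G₁ :- G₀) :+ G₀ :* (con (ℤ.+ 1) :- T))
                                                   P.refl (part (suc r) g) (part r g) t ⟩
        Δ g r +ₚ (part r g *ₚ (1ₚ -ₚ t))      ≈⟨ +ₚ-congˡ (Δ g r) (*ₚ-congˡ (part r g) (≋-sym oneMinusT≋1-t)) ⟩
        Δ g r +ₚ (part r g *ₚ u)              ∎))
        (∣-+ (∣ʳ-respˡ-≈ (P.*-identityʳ u) (bal r)) (x∣ʳyx u (part r g)))
      u∣part : ∀ j → u ∣ part j (u *ₚ g)
      u∣part zero    = ≡.subst (λ X → u ∣ X) (part-≡ n 0 (n%n≡0 n) (u *ₚ g)) (u∣part-suc n')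
      u∣part (suc r) = u∣part-suc r

  Balanced-suc⇒Balanced-1 : ∀ m g → Balanced (suc m) g → Balanced 1 g
  Balanced-suc⇒Balanced-1 m g bal r = ∣ʳ-trans (x∣y⇒zx∣zy u (u ^ m , P.*-identityʳ (u ^ m))) (bal r)

  Φ^∣⇒Balanced : ∀ m g → Φ ^ m ∣ g → Balanced m g
  Φ^∣⇒Balanced zero    g _ r = Δ g r , P.*-identityʳ (Δ g r)
  Φ^∣⇒Balanced (suc m) g (q , qΦ^[1+m]≋g) =
    Balanced-cong (suc m) Φ[qΦ^m]≋g (Balanced-Φ* m (q *ₚ (Φ ^ m)) (Φ^∣⇒Balanced m (q *ₚ (Φ ^ m)) (q , ≋-refl)))
    where
      Φ[qΦ^m]≋g : Φ *ₚ (q *ₚ (Φ ^ m)) ≋ g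
      Φ[qΦ^m]≋g = ≋-trans (solve 3 (λ a b c → b :* (a :* c) := a :* (b :* c)) P.refl q Φ (Φ ^ m)) qΦ^[1+m]≋g

  Balanced⇒Φ^∣ : ∀ m g → Balanced m g → Φ ^ m ∣ g
  Balanced⇒Φ^∣ zero    g _   = g , P.*-identityʳ g
  Balanced⇒Φ^∣ (suc m) g bal = Φ^[1+m]∣g (Balanced-1⇒Φ∣ g (Balanced-suc⇒Balanced-1 m g bal))
    where
      Φ^[1+m]∣g : Φ ∣ g → Φ ^ suc m ∣ g
      Φ^[1+m]∣g (f , fΦ≋g) = ∣ʳ-respʳ-≈ Φf≋g
        (x∣y⇒zx∣zy Φ (Balanced⇒Φ^∣ m f (Balanced-Φ*⁻¹ m f (Balanced-cong (suc m) (≋-sym Φf≋g) bal))))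
        where
          Φf≋g : Φ *ₚ f ≋ g
          Φf≋g = ≋-trans (*ₚ-comm Φ f) fΦ≋g

  Balanced⇒u^∣part-part : ∀ m g → Balanced m g → ∀ j a → u ^ m ∣ (part (a ℕ.+ j) g -ₚ part a g)
  Balanced⇒u^∣part-part m g bal zero a = ∣ʳ-respʳ-≈ (≋-sym (begin
    part (a ℕ.+ 0) g -ₚ part a g  ≡⟨ ≡.cong (λ i → part i g -ₚ part a g) (ℕ.+-identityʳ a) ⟩
    part a g -ₚ part a g          ≈⟨ -ₚ-inverseʳ (part a g) ⟩
    []                            ∎)) ([] , ≋-refl)
  Balanced⇒u^∣part-part m g bal (suc j) a = ∣ʳ-respʳ-≈ (begin
    (part (suc a ℕ.+ j) g -ₚ part (suc a) g) +ₚ Δ g a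
      ≈⟨ solve 3 (λ X Y Z → (X :- Y) :+ (Y :- Z) := X :- Z) P.refl (part (suc a ℕ.+ j) g) (part (suc a) g) (part a g) ⟩
    part (suc a ℕ.+ j) g -ₚ part a g
      ≡⟨ ≡.cong (λ i → part i g -ₚ part a g) (ℕ.+-suc a j) ⟨
    part (a ℕ.+ suc j) g -ₚ part a g ∎)
    (∣-+ (Balanced⇒u^∣part-part m g bal j (suc a)) (bal a))

  Balanced⇒u^∣partsBelow-j*part : ∀ m g → Balanced m g → ∀ r j → j ℕ.≤ n →
    u ^ m ∣ (partsBelow j g -ₚ (const (natToR commutativeRing j) *ₚ part r g))
  Balanced⇒u^∣partsBelow-j*part m g bal r zero _ =
    ∣ʳ-respʳ-≈ (≋-sym (-ₚ-cong (*ₚ-zeroˡ (const 0#) (part r g) const-0))) ([] , ≋-refl)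
  Balanced⇒u^∣partsBelow-j*part m g bal r (suc j) 1+j≤n = ∣ʳ-respʳ-≈ (begin
    (part j g -ₚ part r g) +ₚ (partsBelow j g -ₚ (const N *ₚ part r g))
      ≈⟨ solve 4 (λ Pj S X N → (Pj :- X) :+ (S :- N :* X) := (Pj :+ S) :- (con (ℤ.+ 1) :+ N) :* X)
                 P.refl (part j g) (partsBelow j g) (part r g) (const N) ⟩
    (part j g +ₚ partsBelow j g) -ₚ ((1ₚ +ₚ const N) *ₚ part r g)
      ≡⟨ ≡.cong (λ i → (residuePart n i g +ₚ partsBelow j g) -ₚ ((1ₚ +ₚ const N) *ₚ part r g)) (m<n⇒m%n≡m 1+j≤n) ⟩
    partsBelow (suc j) g -ₚ (const (1# + N) *ₚ part r g) ∎)
    (∣-+ (u^∣part-part j r) (Balanced⇒u^∣partsBelow-j*part m g bal r j (ℕ.<⇒≤ 1+j≤n)))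
    where
      N : Carrier
      N = natToR commutativeRing j
      u^∣part-part : ∀ s r → u ^ m ∣ (part s g -ₚ part r g)
      u^∣part-part s r = ∣ʳ-respʳ-≈
        (solve 3 (λ X Y Z → (X :- Z) :- (Y :- Z) := X :- Y) P.refl (part s g) (part r g) (part 0 g))
        (∣-- (Balanced⇒u^∣part-part m g bal s 0) (Balanced⇒u^∣part-part m g bal r 0))

  Balanced⇒u^∣mean-part : ∀ m g → Balanced m g → ∀ r → u ^ m ∣ ((n⁻¹ ·ₚ g) -ₚ part r g)
  Balanced⇒u^∣mean-part m g bal r = ∣ʳ-respʳ-≈ (begin
    const n⁻¹ *ₚ (partsBelow n g -ₚ (const N *ₚ part r g))
      ≈⟨ *ₚ-congˡ (const n⁻¹) (+ₚ-congʳ (-ₚ (const N *ₚ part r g)) (partsBelow-n g)) ⟩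
    const n⁻¹ *ₚ (g -ₚ (const N *ₚ part r g))
      ≈⟨ solve 4 (λ C G N Y → C :* (G :- N :* Y) := C :* G :- (C :* N) :* Y) P.refl (const n⁻¹) g (const N) (part r g) ⟩
    (const n⁻¹ *ₚ g) -ₚ ((const n⁻¹ *ₚ const N) *ₚ part r g)
      ≈⟨ +ₚ-cong (≋-sym (·ₚ≋const*ₚ n⁻¹ g)) (-ₚ-cong (≋-trans (*ₚ-congʳ (part r g) n⁻¹*n≋1) (*ₚ-identityˡ (part r g)))) ⟩
    (n⁻¹ ·ₚ g) -ₚ part r g ∎)
    (x∣ʳy⇒x∣ʳzy (const n⁻¹) (Balanced⇒u^∣partsBelow-j*part m g bal r n ℕ.≤-refl))
    where
      N : Carrier
      N = natToR commutativeRing n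
      n⁻¹*n≋1 : const n⁻¹ *ₚ const N ≋ 1ₚ
      n⁻¹*n≋1 = ≋-trans (const-* n⁻¹ N) (const-cong n⁻¹*n≈1)

  u^∣mean-part⇒Balanced : ∀ m g → (∀ r → u ^ m ∣ ((n⁻¹ ·ₚ g) -ₚ part r g)) → Balanced m g
  u^∣mean-part⇒Balanced m g u^∣mean-part r = ∣ʳ-respʳ-≈
    (solve 3 (λ M X Y → (M :- X) :- (M :- Y) := Y :- X) P.refl (n⁻¹ ·ₚ g) (part r g) (part (suc r) g))
    (∣-- (u^∣mean-part r) (u^∣mean-part (suc r)))

  Φ^ₚ∣ₚ⇔Balanced : ∀ m g → (Φ ^ₚ m) ∣ₚ g ⇔ Balanced m g
  Φ^ₚ∣ₚ⇔Balanced m g = mk⇔ (Φ^∣⇒Balanced m g) (Balanced⇒Φ^∣ m g) ⇔-∘ ^ₚ∣ₚ⇔^∣ Φ m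

  Balanced⇔≡[modₚ] : ∀ m g →
    Balanced m g ⇔ (∀ (r : Fin n) → (n⁻¹ ·ₚ g) ≡ residuePart n (toℕ r) g [modₚ (u ^ₚ m) ])
  Balanced⇔≡[modₚ] m g = mk⇔
    (λ bal r → Equivalence.from (^ₚ∣ₚ⇔^∣ u m)
      (≡.subst (u^m∣mean-) (≡.cong (λ i → residuePart n i g) (m<n⇒m%n≡m (toℕ<n r)))
               (Balanced⇒u^∣mean-part m g bal (toℕ r))))
    (λ congruent → u^∣mean-part⇒Balanced m g λ r →
      ≡.subst (u^m∣mean-) (≡.cong (λ i → residuePart n i g) (toℕ-fromℕ< (m%n<n r n)))
              (Equivalence.to (^ₚ∣ₚ⇔^∣ u m) (congruent (fromℕ< (m%n<n r n)))))
    where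
      u^m∣mean- : Pol → Set (c ⊔ ℓ)
      u^m∣mean- X = u ^ m ∣ ((n⁻¹ ·ₚ g) -ₚ X)

lemma2p4 : ∀ {c ℓ'} (F : CharZeroField c ℓ') →
    let open CharZeroField F using (commutativeRing) in
    let open Poly commutativeRing in
    (g : Pol) (n : ℕ) .{{_ : NonZero n}} (ℓ : ℕ) →
      ((qInt n ^ₚ suc ℓ) ∣ₚ g)
        ⇔ (∀ (r : Fin n) →
             (invNat F n ·ₚ g) ≡ residuePart n (toℕ r) g [modₚ (oneMinusT ^ₚ suc ℓ) ])
lemma2p4 F g zero ⦃ () ⦄ ℓ
lemma2p4 F g (suc n') ℓ = Balanced⇔≡[modₚ] (suc ℓ) g ⇔-∘ Φ^ₚ∣ₚ⇔Balanced (suc ℓ) g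
  where open QIntegerPowers F n' using (Balanced⇔≡[modₚ]; Φ^ₚ∣ₚ⇔Balanced)
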